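{- Let $G_n$ be the graph defined below and $t\geq1$ an integer. Then $\alpha(G_n^t)\leq \alpha(G_n)^t$, and consequently there is a constant $C=C(t)$ with $\alpha(G_n^t)\leq C n^t$ for all $n$, i.e. $\alpha(G_n^t)=O(n^t)$.
   Context: Let $Q_k=\{0,1\}^k$, $0^k$, $1^k$ the all-zero and all-one vectors, $Q_k^-=Q_k\setminus\{0^k,1^k\}$, and $X\times Y$ the set of concatenations. Let $S = Q_7 \setminus \big[(1^4\times Q_3^-) \cup \{0^4\times 0^3\}\cup\{0^4\times 1^3\}\big]$. $G_n$ has vertex set $[n]^7$, and $x,y$ are adjacent iff $\rho(x,y)\in S$, where $\rho_i(x,y)=1$ if $x_i\neq y_i$ and $0$ otherwise. The OR product of graphs $G$ and $H$ has vertex set $V(G)\times V(H)$, with $(g,h)\sim(g',h')$ iff $g\sim g'$ in $G$ or $h\sim h'$ in $H$; $G^t$ denotes the OR product of $t$ copies of $G$. $\alpha$ is the independence number. -}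

module Defs where

open import Data.Nat using (ℕ; _≤_)
open import Data.Bool using (Bool; true; false; not)
open import Data.Fin using (Fin; _≟_)
open import Data.Vec using (Vec; replicate; _++_; zipWith; lookup)
open import Data.List using (List; length)
open import Data.List.Relation.Unary.AllPairs using (AllPairs)
open import Data.List.Relation.Unary.Unique.Propositional using (Unique)
open import Data.Product using (Σ; _×_)
open import Relation.Nullary using (¬_)
open import Relation.Nullary.Decidable using (⌊_⌋)
open import Relation.Binary.PropositionalEquality using (_≡_; _≢_)

record Graph : Set₁ where
  field
    V   : Set
    Adj : V → V → Set
open Graph public

Q3⁻ : Vec Bool 3 → Set
Q3⁻ w = (w ≢ replicate 3 false) × (w ≢ replicate 3 true)

InS : Vec Bool 7 → Set
InS v = (¬ Σ (Vec Bool 3) (λ w → Q3⁻ w × (v ≡ replicate 4 true ++ w)))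
      × (v ≢ replicate 4 false ++ replicate 3 false)
      × (v ≢ replicate 4 false ++ replicate 3 true)

ρ : ∀ {n} → Vec (Fin n) 7 → Vec (Fin n) 7 → Vec Bool 7
ρ x y = zipWith (λ a b → not ⌊ a ≟ b ⌋) x y

G : ℕ → Graph
G n = record { V = Vec (Fin n) 7 ; Adj = λ x y → InS (ρ x y) }

_^OR_ : Graph → ℕ → Graph
H ^OR t = record
  { V   = Vec (V H) t
  ; Adj = λ x y → Σ (Fin t) (λ i → Adj H (lookup x i) (lookup y i)) }

IsIndependent : (H : Graph) → List (V H) → Set
IsIndependent H I = Unique I × AllPairs (λ x y → ¬ Adj H x y × ¬ Adj H y x) I

IsIndependenceNumber : Graph → ℕ → Set
IsIndependenceNumber H a =
  Σ (List (V H)) (λ I → IsIndependent H I × (length I ≡ a))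
  × ((I : List (V H)) → IsIndependent H I → length I ≤ a)

-- For the OR product, an independent set I of H^(t+1) is split by first coordinates: the first
-- coordinates of I form an independent set of H, and over each of them the remaining coordinates
-- form an independent set of H^t, so |I| ≤ α(H)·α(H)^t. For G_n, two distinct non-adjacent
-- vertices x, y have ρ(x,y) ∈ 1⁴ × Q₃⁻ or ρ(x,y) = 0⁴1³: if x₁ = y₁ they differ in all of the
-- last three coordinates, otherwise they agree in one of them. So inside an independent set the
-- vertices with a fixed first coordinate a pairwise differ in the last three coordinates; if some
-- w has first coordinate ≠ a, each of them agrees with w in one of three places, and no two in the
-- same place, so there are at most 3 of them. Either all first coordinates coincide (and then the
-- fifth coordinate is injective, giving |I| ≤ n) or every fibre has size ≤ 3, giving |I| ≤ 3n.
-- Hence α(G_n^t) ≤ (3n)^t.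
module Submission where

open import Defs
open import Data.Bool using (Bool; true; false; not)
open import Data.Bool.Properties using (not-¬)
open import Data.Empty using (⊥; ⊥-elim)
open import Data.Fin using (Fin; zero; suc; _↑ʳ_; _≟_)
open import Data.Fin.Properties using (any?)
open import Data.List using (List; []; _∷_; length; map; filter; deduplicate; allFin)
open import Data.List.Properties using (length-map; length-tabulate)
open import Data.List.Membership.Propositional using (_∈_; find)
open import Data.List.Membership.Propositional.Properties
  using (∈-map⁺; ∈-filter⁻; ∈-deduplicate⁺; ∈-allFin)
open import Data.List.Relation.Binary.Sublist.Propositional.Properties
  using (filter-⊆; length-mono-≤) renaming (filter⁺ to ⊆-filter⁺)
open import Data.List.Relation.Unary.All as All using (All; []; _∷_; all?)
open import Data.List.Relation.Unary.All.Properties as All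
  using (all-filter; ¬All⇒Any¬)
open import Data.List.Relation.Unary.AllPairs as AllPairs using (AllPairs; []; _∷_)
import Data.List.Relation.Unary.AllPairs.Properties as AllPairs
open import Data.List.Relation.Unary.Any using (Any; here; there)
open import Data.List.Relation.Unary.Any.Properties using (tabulate⁺)
open import Data.List.Relation.Unary.Unique.DecPropositional.Properties using (deduplicate-!)
open import Data.Nat using (ℕ; zero; suc; _≤_; _+_; _*_; _^_; z≤n; s≤s)
open import Data.Nat.Properties
  using (+-suc; +-mono-≤; *-monoˡ-≤; *-comm; *-identityʳ; m≤m+n; ≤-trans; module ≤-Reasoning;
         *-commutativeSemigroup)
open import Algebra.Properties.CommutativeSemigroup *-commutativeSemigroup using (interchange)
open import Data.Product as Product using (Σ; ∃; _×_; _,_)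
open import Data.Sum using (_⊎_; inj₁; inj₂)
open import Data.Vec using (Vec; []; _∷_; head; tail; lookup; replicate; _++_)
open import Data.Vec.Properties using (≡-dec; lookup-zipWith; lookup-replicate)
open import Data.Vec.Relation.Binary.Pointwise.Extensional using (ext; Pointwise-≡⇒≡)
open import Function using (_∘_; id)
open import Relation.Binary using (DecidableEquality)
open import Relation.Binary.PropositionalEquality
  using (_≡_; _≢_; refl; sym; trans; cong; subst; module ≡-Reasoning)
open import Relation.Nullary using (¬_; yes; no)
open import Relation.Nullary.Decidable using (isYes≗does; dec-true; dec-false; decidable-stable)
open import Relation.Unary using (Decidable)
open import Relation.Unary.Properties using (∁?)

private
  variable
    A B : Set

length-filter+length-filter-∁ : {P : A → Set} (P? : Decidable P) (xs : List A) →
  length (filter P? xs) + length (filter (∁? P?) xs) ≡ length xs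
length-filter+length-filter-∁ P? [] = refl
length-filter+length-filter-∁ P? (x ∷ xs) with P? x
... | yes _ = cong suc (length-filter+length-filter-∁ P? xs)
... | no _  = trans (+-suc _ _) (cong suc (length-filter+length-filter-∁ P? xs))

length-filter≤1 : {P : A → Set} (P? : Decidable P) {xs : List A} →
  AllPairs (λ x y → P x → P y → ⊥) xs → length (filter P? xs) ≤ 1
length-filter≤1 P? {xs} exclusive =
  atMostOne (AllPairs.filter⁺ P? exclusive) (all-filter P? xs)
  where
  atMostOne : ∀ {ys} → AllPairs (λ x y → _ → _ → ⊥) ys → All _ ys → length ys ≤ 1
  atMostOne {[]}         _             _             = z≤n
  atMostOne {_ ∷ []}     _             _             = s≤s z≤n
  atMostOne {_ ∷ _ ∷ _} ((r ∷ _) ∷ _) (px ∷ py ∷ _) = ⊥-elim (r px py)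

module _ {P : B → A → Set} (P? : ∀ b → Decidable (P b)) where

  length≤length*-of-cover : ∀ k (D : List B) {xs : List A} →
    All (λ x → Any (λ b → P b x) D) xs → (∀ b → length (filter (P? b) xs) ≤ k) →
    length xs ≤ length D * k
  length≤length*-of-cover k [] {[]} _ _ = z≤n
  length≤length*-of-cover k [] {_ ∷ _} (() ∷ _) _
  length≤length*-of-cover k (b ∷ D) {xs} covered bounded = begin
    length xs
      ≡⟨ sym (length-filter+length-filter-∁ (P? b) xs) ⟩
    length (filter (P? b) xs) + length rest
      ≤⟨ +-mono-≤ (bounded b) (length≤length*-of-cover k D restCovered restBounded) ⟩
    k + length D * k ∎
    where
    open ≤-Reasoning
    rest : List A
    rest = filter (∁? (P? b)) xs
    restCovered : All (λ x → Any (λ b → P b x) D) rest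
    restCovered = All.zipWith (λ { (here p , ¬p) → ⊥-elim (¬p p) ; (there c , _) → c })
                              (All.filter⁺ (∁? (P? b)) covered , all-filter (∁? (P? b)) xs)
    restBounded : ∀ b′ → length (filter (P? b′) rest) ≤ k
    restBounded b′ = ≤-trans
      (length-mono-≤ (⊆-filter⁺ (P? b′) (P? b′) (λ { refl p → p }) (filter-⊆ (∁? (P? b)) xs)))
      (bounded b′)

AllPairs-deduplicate⁺ : ∀ {R : A → A → Set} (_≟ᴬ_ : DecidableEquality A) {xs : List A} →
  AllPairs R xs → AllPairs R (deduplicate _≟ᴬ_ xs)
AllPairs-deduplicate⁺ _≟ᴬ_ [] = []
AllPairs-deduplicate⁺ _≟ᴬ_ (rx ∷ rxs) =
  All.filter⁺ _ (All.deduplicate⁺ _≟ᴬ_ rx) ∷ AllPairs.filter⁺ _ (AllPairs-deduplicate⁺ _≟ᴬ_ rxs)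

AllPairs-mapWithAll : ∀ {P : A → Set} {R S : A → A → Set} →
  (∀ {x y} → P x → P y → R x y → S x y) → ∀ {xs} → All P xs → AllPairs R xs → AllPairs S xs
AllPairs-mapWithAll f []         []         = []
AllPairs-mapWithAll f (px ∷ pxs) (rx ∷ rxs) =
  All.zipWith (λ (py , r) → f px py r) (pxs , rx) ∷ AllPairs-mapWithAll f pxs rxs

AllPairs-∈ : ∀ {R : A → A → Set} {xs : List A} → AllPairs R xs →
  ∀ {x y} → x ∈ xs → y ∈ xs → x ≢ y → R x y ⊎ R y x
AllPairs-∈ (rx ∷ rxs) (here refl) (here refl) x≢y = ⊥-elim (x≢y refl)
AllPairs-∈ (rx ∷ rxs) (here refl) (there y∈) _   = inj₁ (All.lookup rx y∈)
AllPairs-∈ (rx ∷ rxs) (there x∈)  (here refl) _  = inj₂ (All.lookup rx x∈)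
AllPairs-∈ (rx ∷ rxs) (there x∈)  (there y∈) x≢y = AllPairs-∈ rxs x∈ y∈ x≢y

^-distribʳ-* : ∀ m n o → (m * n) ^ o ≡ m ^ o * n ^ o
^-distribʳ-* m n zero    = refl
^-distribʳ-* m n (suc o) = begin
  m * n * (m * n) ^ o     ≡⟨ cong (m * n *_) (^-distribʳ-* m n o) ⟩
  m * n * (m ^ o * n ^ o) ≡⟨ interchange m n (m ^ o) (n ^ o) ⟩
  m * m ^ o * (n * n ^ o) ∎
  where open ≡-Reasoning

IsIndependent-filter⁺ : ∀ H {P : V H → Set} (P? : Decidable P) {I : List (V H)} →
  IsIndependent H I → IsIndependent H (filter P? I)
IsIndependent-filter⁺ H P? (distinct , nonadjacent) =
  AllPairs.filter⁺ P? distinct , AllPairs.filter⁺ P? nonadjacent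

IsIndependent⇒¬Adj : ∀ H {I : List (V H)} → IsIndependent H I →
  ∀ {x y} → x ∈ I → y ∈ I → x ≢ y → ¬ Adj H x y
IsIndependent⇒¬Adj H (_ , nonadjacent) x∈I y∈I x≢y with AllPairs-∈ nonadjacent x∈I y∈I x≢y
... | inj₁ (¬xy , _) = ¬xy
... | inj₂ (_ , ¬xy) = ¬xy

module _ (H : Graph) where

  ¬Adj-^OR-head : ∀ {t} (x y : Vec (V H) (suc t)) →
    ¬ Adj (H ^OR suc t) x y → ¬ Adj H (head x) (head y)
  ¬Adj-^OR-head (_ ∷ _) (_ ∷ _) ¬adj adj = ¬adj (zero , adj)

  ¬Adj-^OR-tail : ∀ {t} (x y : Vec (V H) (suc t)) →
    ¬ Adj (H ^OR suc t) x y → ¬ Adj (H ^OR t) (tail x) (tail y)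
  ¬Adj-^OR-tail (_ ∷ _) (_ ∷ _) ¬adj (i , adj) = ¬adj (suc i , adj)

  module _ (_≟ⱽ_ : DecidableEquality (V H)) where

    heads-independent : ∀ {t} {I : List (Vec (V H) (suc t))} → IsIndependent (H ^OR suc t) I →
      IsIndependent H (deduplicate _≟ⱽ_ (map head I))
    heads-independent {I = I} (_ , nonadjacent) =
      deduplicate-! _≟ⱽ_ (map head I) ,
      AllPairs-deduplicate⁺ _≟ⱽ_
        (AllPairs.map⁺ (AllPairs.map (λ {x} {y} → Product.map (¬Adj-^OR-head x y) (¬Adj-^OR-head y x))
                                     nonadjacent))

    fibre-tails-independent : ∀ {t} {I : List (Vec (V H) (suc t))} (b : V H) →
      IsIndependent (H ^OR suc t) I →
      IsIndependent (H ^OR t) (map tail (filter (λ x → head x ≟ⱽ b) I))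
    fibre-tails-independent {I = I} b independent
      with IsIndependent-filter⁺ (H ^OR suc _) (λ x → head x ≟ⱽ b) independent
    ... | distinct , nonadjacent =
      AllPairs.map⁺ (AllPairs-mapWithAll tail-injective (all-filter _ I) distinct) ,
      AllPairs.map⁺ (AllPairs.map (λ {x} {y} → Product.map (¬Adj-^OR-tail x y) (¬Adj-^OR-tail y x))
                                  nonadjacent)
      where
      tail-injective : ∀ {t} {x y : Vec (V H) (suc t)} →
        head x ≡ b → head y ≡ b → x ≢ y → tail x ≢ tail y
      tail-injective {x = _ ∷ _} {_ ∷ _} refl refl x≢y refl = x≢y refl

    IsIndependent-^OR-length≤ : ∀ {α} → (∀ I → IsIndependent H I → length I ≤ α) →
      ∀ t (I : List (Vec (V H) t)) → IsIndependent (H ^OR t) I → length I ≤ α ^ t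
    IsIndependent-^OR-length≤ _ zero []            _                   = z≤n
    IsIndependent-^OR-length≤ _ zero (_ ∷ [])      _                   = s≤s z≤n
    IsIndependent-^OR-length≤ _ zero ([] ∷ [] ∷ _) ((x≢y ∷ _) ∷ _ , _) = ⊥-elim (x≢y refl)
    IsIndependent-^OR-length≤ {α} α-bound (suc t) I independent = begin
      length I
        ≤⟨ length≤length*-of-cover (λ b x → head x ≟ⱽ b) (α ^ t) heads headsCovered fibreBound ⟩
      length heads * α ^ t
        ≤⟨ *-monoˡ-≤ (α ^ t) (α-bound heads (heads-independent independent)) ⟩
      α * α ^ t ∎
      where
      open ≤-Reasoning
      heads : List (V H)
      heads = deduplicate _≟ⱽ_ (map head I)
      headsCovered : All (λ x → head x ∈ heads) I
      headsCovered = All.tabulate (λ x∈I → ∈-deduplicate⁺ _≟ⱽ_ (∈-map⁺ head x∈I))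
      fibreBound : ∀ b → length (filter (λ x → head x ≟ⱽ b) I) ≤ α ^ t
      fibreBound b = begin
        length (filter (λ x → head x ≟ⱽ b) I)
          ≡⟨ sym (length-map tail (filter (λ x → head x ≟ⱽ b) I)) ⟩
        length (map tail (filter (λ x → head x ≟ⱽ b) I))
          ≤⟨ IsIndependent-^OR-length≤ α-bound t _ (fibre-tails-independent {I = I} b independent) ⟩
        α ^ t ∎

module _ {n : ℕ} where

  private
    Vertex : Set
    Vertex = Vec (Fin n) 7

  coord : Fin 7 → Vertex → Fin n
  coord j x = lookup x j

  -- The last three coordinates (5, 6, 7 in the paper) are 4 ↑ʳ i for i : Fin 3.
  LastThreeDiffer : Vertex → Vertex → Set
  LastThreeDiffer x y = ∀ i → coord (4 ↑ʳ i) x ≢ coord (4 ↑ʳ i) y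

  LastThreeAgree : Vertex → Vertex → Set
  LastThreeAgree x y = ∃ λ i → coord (4 ↑ʳ i) x ≡ coord (4 ↑ʳ i) y

  ρ-lookup-≡ : ∀ (x y : Vertex) j → coord j x ≡ coord j y → lookup (ρ x y) j ≡ false
  ρ-lookup-≡ x y j eq = trans (lookup-zipWith _ j x y)
    (cong not (trans (isYes≗does _) (dec-true (coord j x ≟ coord j y) eq)))

  ρ-lookup-≢ : ∀ (x y : Vertex) j → coord j x ≢ coord j y → lookup (ρ x y) j ≡ true
  ρ-lookup-≢ x y j ne = trans (lookup-zipWith _ j x y)
    (cong not (trans (isYes≗does _) (dec-false (coord j x ≟ coord j y) ne)))

  ρ≢ : ∀ (x y : Vertex) {v : Vec Bool 7} {b} j → lookup (ρ x y) j ≡ b → lookup v j ≢ b → ρ x y ≢ v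
  ρ≢ x y j ρⱼ≡b vⱼ≢b refl = vⱼ≢b ρⱼ≡b

  ρ≡0⇒≡ : ∀ {x y : Vertex} → ρ x y ≡ replicate 7 false → x ≡ y
  ρ≡0⇒≡ {x} {y} ρ≡0 = Pointwise-≡⇒≡ (ext λ j →
    decidable-stable (coord j x ≟ coord j y)
      (λ ne → ρ≢ x y j (ρ-lookup-≢ x y j ne) (not-¬ (lookup-replicate j false)) ρ≡0))

  sameHead⇒LastThreeDiffer : ∀ {x y : Vertex} → x ≢ y → ¬ InS (ρ x y) →
    coord zero x ≡ coord zero y → LastThreeDiffer x y
  sameHead⇒LastThreeDiffer {x} {y} x≢y ρ∉S heads≡ i agree = ρ∉S (ρ∉1⁴Q₃⁻ , ρ≢0⁴0³ , ρ≢0⁴1³)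
    where
    ρ∉1⁴Q₃⁻ : ¬ Σ (Vec Bool 3) (λ w → Q3⁻ w × (ρ x y ≡ replicate 4 true ++ w))
    ρ∉1⁴Q₃⁻ (_ , _ , eq) = ρ≢ x y zero (ρ-lookup-≡ x y zero heads≡) (λ ()) eq
    ρ≢0⁴0³ : ρ x y ≢ replicate 4 false ++ replicate 3 false
    ρ≢0⁴0³ = x≢y ∘ ρ≡0⇒≡
    ρ≢0⁴1³ : ρ x y ≢ replicate 4 false ++ replicate 3 true
    ρ≢0⁴1³ = ρ≢ x y (4 ↑ʳ i) (ρ-lookup-≡ x y (4 ↑ʳ i) agree) (not-¬ (lookup-replicate i true))

  differentHead⇒LastThreeAgree : ∀ {x y : Vertex} → ¬ InS (ρ x y) →
    coord zero x ≢ coord zero y → LastThreeAgree x y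
  differentHead⇒LastThreeAgree {x} {y} ρ∉S heads≢ =
    decidable-stable (any? λ i → coord (4 ↑ʳ i) x ≟ coord (4 ↑ʳ i) y)
      (λ ¬agree → ρ∉S (ρ∉1⁴Q₃⁻ (λ i → ¬agree ∘ (i ,_)) , ρ≢0⁴v , ρ≢0⁴v))
    where
    ρ₀≡true : lookup (ρ x y) zero ≡ true
    ρ₀≡true = ρ-lookup-≢ x y zero heads≢
    ρ≢0⁴v : ∀ {v} → ρ x y ≢ replicate 4 false ++ v
    ρ≢0⁴v = ρ≢ x y zero ρ₀≡true (λ ())
    -- Differing last three coordinates force w = 1³, which Q₃⁻ excludes.
    ρ∉1⁴Q₃⁻ : LastThreeDiffer x y →
      ¬ Σ (Vec Bool 3) (λ w → Q3⁻ w × (ρ x y ≡ replicate 4 true ++ w))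
    ρ∉1⁴Q₃⁻ differ (w , (_ , w≢1³) , eq) = w≢1³ (Pointwise-≡⇒≡ (ext λ i →
      trans (cong (λ v → lookup v (4 ↑ʳ i)) (sym eq))
            (trans (ρ-lookup-≢ x y (4 ↑ʳ i) (differ i)) (sym (lookup-replicate i true)))))

  IsIndependent⇒LastThreeDiffer : ∀ {I : List Vertex} {a} → IsIndependent (G n) I →
    All (λ z → coord zero z ≡ a) I → AllPairs LastThreeDiffer I
  IsIndependent⇒LastThreeDiffer (distinct , nonadjacent) sameHead =
    AllPairs-mapWithAll
      (λ hx hy (x≢y , ¬xy , _) → sameHead⇒LastThreeDiffer x≢y ¬xy (trans hx (sym hy)))
      sameHead (AllPairs.zip (distinct , nonadjacent))

  constantHead-length≤n : ∀ {I : List Vertex} {a} → IsIndependent (G n) I →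
    All (λ z → coord zero z ≡ a) I → length I ≤ n
  constantHead-length≤n {I} independent sameHead = begin
    length I ≤⟨ length≤length*-of-cover (λ b z → coord (4 ↑ʳ zero) z ≟ b) 1 (allFin n) {I}
           (All.tabulate (λ _ → ∈-allFin _)) atMostOne ⟩
    length (allFin n) * 1 ≡⟨ *-identityʳ _ ⟩
    length (allFin n)     ≡⟨ length-tabulate {n = n} id ⟩
    n ∎
    where
    open ≤-Reasoning
    atMostOne : ∀ b → length (filter (λ z → coord (4 ↑ʳ zero) z ≟ b) I) ≤ 1
    atMostOne b = length-filter≤1 _ {I}
      (AllPairs.map (λ differ eq eq′ → differ zero (trans eq (sym eq′)))
                    (IsIndependent⇒LastThreeDiffer independent sameHead))

  fibre-length≤3 : ∀ {I : List Vertex} {w a} → IsIndependent (G n) I → w ∈ I → coord zero w ≢ a →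
    length (filter (λ z → coord zero z ≟ a) I) ≤ 3
  fibre-length≤3 {I} {w} {a} independent w∈I w≢a =
    length≤length*-of-cover (λ i z → coord (4 ↑ʳ i) z ≟ coord (4 ↑ʳ i) w) 1 (allFin 3)
      (All.tabulate agreesWith-w) atMostOne
    where
    fibre : List Vertex
    fibre = filter (λ z → coord zero z ≟ a) I
    agreesWith-w : ∀ {z} → z ∈ fibre → Any (λ i → coord (4 ↑ʳ i) z ≡ coord (4 ↑ʳ i) w) (allFin 3)
    agreesWith-w z∈fibre with ∈-filter⁻ (λ z → coord zero z ≟ a) z∈fibre
    ... | z∈I , z≡a with differentHead⇒LastThreeAgree
                           (IsIndependent⇒¬Adj (G n) independent z∈I w∈I (λ { refl → w≢a z≡a }))
                           (λ eq → w≢a (trans (sym eq) z≡a))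
    ...   | i , agree = tabulate⁺ {f = id} i agree
    atMostOne : ∀ i → length (filter (λ z → coord (4 ↑ʳ i) z ≟ coord (4 ↑ʳ i) w) fibre) ≤ 1
    atMostOne i = length-filter≤1 _ {fibre}
      (AllPairs.map (λ differ eq eq′ → differ i (trans eq (sym eq′)))
        (IsIndependent⇒LastThreeDiffer (IsIndependent-filter⁺ (G n) _ independent) (all-filter _ I)))

  IsIndependent-G-length≤3n : ∀ (I : List Vertex) → IsIndependent (G n) I → length I ≤ 3 * n
  IsIndependent-G-length≤3n [] _ = z≤n
  IsIndependent-G-length≤3n I@(x ∷ _) independent with all? (λ z → coord zero z ≟ coord zero x) I
  ... | yes sameHead = ≤-trans (constantHead-length≤n independent sameHead) (m≤m+n n _)
  ... | no ¬sameHead = begin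
    length I              ≤⟨ length≤length*-of-cover (λ a z → coord zero z ≟ a) 3 (allFin n) {I}
                               (All.tabulate (λ _ → ∈-allFin _)) fibreBound ⟩
    length (allFin n) * 3 ≡⟨ cong (_* 3) (length-tabulate {n = n} id) ⟩
    n * 3                 ≡⟨ *-comm n 3 ⟩
    3 * n ∎
    where
    open ≤-Reasoning
    fibreBound : ∀ a → length (filter (λ z → coord zero z ≟ a) I) ≤ 3
    fibreBound a with a ≟ coord zero x
    ... | no a≢x   = fibre-length≤3 independent (here refl) (a≢x ∘ sym)
    ... | yes refl with find (¬All⇒Any¬ (λ z → coord zero z ≟ coord zero x) I ¬sameHead)
    ...   | _ , y∈I , y≢x = fibre-length≤3 independent y∈I y≢x

claim3p3 : ((n t : ℕ) → 1 ≤ t → (a b : ℕ) → IsIndependenceNumber (G n ^OR t) a → IsIndependenceNumber (G n) b → a ≤ b ^ t)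
    × ((t : ℕ) → 1 ≤ t → Σ ℕ (λ C → (n a : ℕ) → IsIndependenceNumber (G n ^OR t) a → a ≤ C * n ^ t))
claim3p3 = α-^OR≤α^t , λ t _ → 3 ^ t , α-G^OR≤3^t*n^t t
  where
  α-^OR≤α^t : (n t : ℕ) → 1 ≤ t → (a b : ℕ) →
    IsIndependenceNumber (G n ^OR t) a → IsIndependenceNumber (G n) b → a ≤ b ^ t
  α-^OR≤α^t n t _ a b ((I , independent , refl) , _) (_ , α-bound) =
    IsIndependent-^OR-length≤ (G n) (≡-dec _≟_) α-bound t I independent

  α-G^OR≤3^t*n^t : (t n a : ℕ) → IsIndependenceNumber (G n ^OR t) a → a ≤ 3 ^ t * n ^ t
  α-G^OR≤3^t*n^t t n a ((I , independent , refl) , _) =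
    subst (length I ≤_) (^-distribʳ-* 3 n t)
      (IsIndependent-^OR-length≤ (G n) (≡-dec _≟_) IsIndependent-G-length≤3n t I independent)
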